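{- Let $n\ge1$, let $\Lambda^*\subseteq\mathbb{Z}^n$ be a full-rank lattice, and let $\bar G_1^*$, $\bar G_2^*$ be two $n\times n$ generator matrices of $\Lambda^*$ with Gram matrices $A_1^*=\bar G_1^*\bar G_1^{*t}$, $A_2^*=\bar G_2^*\bar G_2^{*t}$. Put $G_i^*=[\bar G_i^*\;\;0_{n\times1}]$ for $i=1,2$. Let $P_1$ be an $n\times(n+1)$ integer matrix, $G_{w,1}^*=wG_1^*+P_1$ for $w\in\mathbb{N}$, and $H_{w,1}$ the matrix of the last $n$ columns of $G_{w,1}^*$. Suppose $\det H_{w,1}=\pm1$ for all $w\in\mathbb{N}$ and that there is $\alpha$ with $G_1^*P_1^t+P_1G_1^{*t}=\alpha A_1^*$. Then there exists an $n\times(n+1)$ integer matrix $P_2$ such that, with $G_{w,2}^*=wG_2^*+P_2$ and $H_{w,2}$ the matrix of the last $n$ columns of $G_{w,2}^*$, one has $\det H_{w,2}=\pm1$ for all $w\in\mathbb{N}$, there is $\alpha'$ with $G_2^*P_2^t+P_2G_2^{*t}=\alpha' A_2^*$, and $$H_{w,1}^{ -1}G_1^*=H_{w,2}^{ -1}G_2^*\quad\text{for all } w\in\mathbb{N}.$$ -}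

module Defs where

open import Data.Nat as ℕ using (ℕ; zero; suc)
open import Data.Fin using (Fin; zero; suc; toℕ; fromℕ; punchIn)
open import Data.Integer using (ℤ; +_; -_; _+_; _*_; 0ℤ; 1ℤ; -1ℤ)
open import Data.Product using (Σ; ∃; _×_)
open import Data.Sum using (_⊎_)
open import Data.Vec.Functional using (insertAt)
open import Relation.Binary.PropositionalEquality using (_≡_)

Mat : ℕ → ℕ → Set
Mat m n = Fin m → Fin n → ℤ

infixl 7 _·_ _⊙_
infixl 6 _⊕_
infix 4 _≐_

∑ : ∀ {n} → (Fin n → ℤ) → ℤ
∑ {zero}  f = 0ℤ
∑ {suc n} f = f zero + ∑ (λ i → f (suc i))

_·_ : ∀ {m k n} → Mat m k → Mat k n → Mat m n
(A · B) i j = ∑ (λ l → A i l * B l j)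

_ᵗ : ∀ {m n} → Mat m n → Mat n m
(A ᵗ) i j = A j i

_⊕_ : ∀ {m n} → Mat m n → Mat m n → Mat m n
(A ⊕ B) i j = A i j + B i j

_⊙_ : ∀ {m n} → ℤ → Mat m n → Mat m n
(c ⊙ A) i j = c * A i j

identity : ∀ {n} → Mat n n
identity {suc n} zero    zero    = 1ℤ
identity {suc n} zero    (suc j) = 0ℤ
identity {suc n} (suc i) zero    = 0ℤ
identity {suc n} (suc i) (suc j) = identity i j

sign : ℕ → ℤ
sign zero          = 1ℤ
sign (suc zero)    = -1ℤ
sign (suc (suc k)) = sign k

det : ∀ {n} → Mat n n → ℤ
det {zero}  M = 1ℤ
det {suc n} M = ∑ (λ j → sign (toℕ j) * (M zero j * det (λ i k → M (suc i) (punchIn j k))))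

-- pointwise equality of matrices (no funext in --safe Agda)
_≐_ : ∀ {m n} → Mat m n → Mat m n → Set
A ≐ B = ∀ i j → A i j ≡ B i j

IsInverse : ∀ {n} → Mat n n → Mat n n → Set
IsInverse M H = (M · H ≐ identity) × (H · M ≐ identity)

InLattice : ∀ {n} → Mat n n → (Fin n → ℤ) → Set
InLattice {n} G v = ∃ λ (x : Fin n → ℤ) → ∀ j → ∑ (λ i → x i * G i j) ≡ v j

appendZeroCol : ∀ {m n} → Mat m n → Mat m (suc n)
appendZeroCol {n = n} G i = insertAt (G i) (fromℕ n) 0ℤ

lastCols : ∀ {m n} → Mat m (suc n) → Mat m n
lastCols M i j = M i (suc j)

Gw : ∀ {n} → ℕ → Mat n (suc n) → Mat n (suc n) → Mat n (suc n)
Gw w G P = ((+ w) ⊙ G) ⊕ P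

Unimodular : ∀ {n} → Mat n n → Set
Unimodular H = (det H ≡ 1ℤ) ⊎ (det H ≡ -1ℤ)

-- ∃ α ∈ ℚ (written α = p/q, q ≥ 1) with G Pᵗ + P Gᵗ = α A,
-- i.e. q (G Pᵗ + P Gᵗ) = p A.
SymCond : ∀ {n} → Mat n (suc n) → Mat n (suc n) → Mat n n → Set
SymCond G P A = Σ ℤ λ p → Σ ℕ λ q →
  ((+ suc q) ⊙ ((G · (P ᵗ)) ⊕ (P · (G ᵗ)))) ≐ (p ⊙ A)

-- Two generator matrices Ḡ₁, Ḡ₂ of the same full-rank lattice differ by a
-- unimodular change of basis: Ḡ₂ = U Ḡ₁ with det U = ±1. Taking P₂ = U P₁
-- gives G*_{w,2} = U G*_{w,1}, hence H_{w,2} = U H_{w,1}. Therefore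
-- det H_{w,2} = ±1, the condition G Pᵗ + P Gᵗ = α A is carried along by the
-- congruence X ↦ U X Uᵗ with the same α, and H_{w,2}⁻¹ G₂* = H_{w,1}⁻¹ G₁*.
--
-- The one non-formal ingredient is multiplicativity of the determinant, which
-- Defs defines by Laplace expansion along the first row.
module Submission where

open import Defs
open import Data.Nat as ℕ using (ℕ; zero; suc; z≤n; _≤_)
import Data.Nat.Properties as ℕₚ
open import Data.Fin using (Fin; zero; suc; toℕ; fromℕ; fromℕ<; inject₁; punchIn; punchOut; _≟_)
open import Data.Fin.Properties
  using (suc-injective; toℕ<n; toℕ-fromℕ<; toℕ-inject₁; toℕ-injective; punchIn-punchOut; punchInᵢ≢i)
open import Data.Integer as ℤ using (ℤ; -[1+_]; -_; _+_; _*_; 0ℤ; 1ℤ; -1ℤ; ∣_∣)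
open import Data.Integer.Base using (≢-nonZero)
open import Data.Integer.Properties
  using ( +-*-semiring; +-comm; +-identityˡ; +-identityʳ; +-inverseˡ; +-inverseʳ; *-comm; *-assoc
        ; *-identityˡ; *-identityʳ; *-zeroˡ; *-zeroʳ; *-distribˡ-+; *-distribʳ-+; -1*i≡-i
        ; neg-involutive; neg-distribˡ-*; abs-*; *-cancelʳ-≡ )
open import Data.Integer.Tactic.RingSolver using (solve-∀)
open import Algebra.Properties.Semiring.Sum +-*-semiring
  using (sum; sum-cong-≗; ∑-distrib-+; ∑-comm; sum-remove; sum-replicate-zero; *-distribˡ-sum)
open import Data.Vec.Functional using (_∷_; insertAt; updateAt)
open import Data.Vec.Functional.Properties
  using (insertAt-lookup; insertAt-punchIn; updateAt-updates; updateAt-minimal)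
open import Data.Product using (Σ; _×_; _,_; proj₁; proj₂)
open import Data.Sum using (_⊎_; inj₁; inj₂)
open import Data.Empty using (⊥-elim)
open import Function using (const)
open import Function.Bundles using (_⇔_; Equivalence)
open import Relation.Nullary using (¬_; yes; no)
open import Relation.Binary.Bundles using (Setoid)
import Relation.Binary.Reasoning.Setoid as SetoidReasoning
open import Relation.Binary.PropositionalEquality

∑≡sum : ∀ {n} (f : Fin n → ℤ) → ∑ f ≡ sum f
∑≡sum {zero}  f = refl
∑≡sum {suc n} f = cong (f zero +_) (∑≡sum (λ i → f (suc i)))

∑-cong : ∀ {n} {f g : Fin n → ℤ} → (∀ i → f i ≡ g i) → ∑ f ≡ ∑ g
∑-cong {f = f} {g} f≗g = trans (∑≡sum f) (trans (sum-cong-≗ f≗g) (sym (∑≡sum g)))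

∑-+ : ∀ {n} (f g : Fin n → ℤ) → ∑ (λ i → f i + g i) ≡ ∑ f + ∑ g
∑-+ f g = trans (∑≡sum (λ i → f i + g i)) (trans (∑-distrib-+ f g) (sym (cong₂ _+_ (∑≡sum f) (∑≡sum g))))

∑-*ˡ : ∀ {n} (c : ℤ) (f : Fin n → ℤ) → ∑ (λ i → c * f i) ≡ c * ∑ f
∑-*ˡ c f = trans (∑≡sum (λ i → c * f i)) (sym (trans (cong (c *_) (∑≡sum f)) (*-distribˡ-sum c f)))

∑-*ʳ : ∀ {n} (c : ℤ) (f : Fin n → ℤ) → ∑ (λ i → f i * c) ≡ ∑ f * c
∑-*ʳ c f = trans (∑-cong (λ i → *-comm (f i) c)) (trans (∑-*ˡ c f) (*-comm c (∑ f)))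

∑-neg : ∀ {n} (f : Fin n → ℤ) → ∑ (λ i → - f i) ≡ - ∑ f
∑-neg f = trans (∑-cong (λ i → sym (-1*i≡-i (f i)))) (trans (∑-*ˡ -1ℤ f) (-1*i≡-i (∑ f)))

∑-zero : ∀ {n} {f : Fin n → ℤ} → (∀ i → f i ≡ 0ℤ) → ∑ f ≡ 0ℤ
∑-zero {n} f≗0 = trans (∑-cong {g = λ _ → 0ℤ} f≗0) (trans (∑≡sum {n} (λ _ → 0ℤ)) (sum-replicate-zero n))

∑-swap : ∀ {m n} (f : Fin m → Fin n → ℤ) → ∑ (λ i → ∑ (f i)) ≡ ∑ (λ j → ∑ (λ i → f i j))
∑-swap f = begin
  ∑ (λ i → ∑ (f i))              ≡⟨ ∑-cong (λ i → ∑≡sum (f i)) ⟩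
  ∑ (λ i → sum (f i))            ≡⟨ ∑≡sum (λ i → sum (f i)) ⟩
  sum (λ i → sum (f i))          ≡⟨ ∑-comm f ⟩
  sum (λ j → sum (λ i → f i j))  ≡⟨ sym (∑≡sum (λ j → sum (λ i → f i j))) ⟩
  ∑ (λ j → sum (λ i → f i j))    ≡⟨ sym (∑-cong (λ j → ∑≡sum (λ i → f i j))) ⟩
  ∑ (λ j → ∑ (λ i → f i j))      ∎
  where open ≡-Reasoning

∑-punchIn : ∀ {n} (f : Fin (suc n) → ℤ) (j : Fin (suc n)) → ∑ f ≡ f j + ∑ (λ k → f (punchIn j k))
∑-punchIn f j = trans (∑≡sum f) (trans (sum-remove f) (cong (f j +_) (sym (∑≡sum (λ k → f (punchIn j k))))))

∑-δ : ∀ {n} (f : Fin n → ℤ) (j : Fin n) → (∀ c → c ≢ j → f c ≡ 0ℤ) → ∑ f ≡ f j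
∑-δ {suc n} f j off = begin
  ∑ f                                ≡⟨ ∑-punchIn f j ⟩
  f j + ∑ (λ k → f (punchIn j k))    ≡⟨ cong (f j +_) (∑-zero (λ k → off _ (punchInᵢ≢i j k))) ⟩
  f j + 0ℤ                           ≡⟨ +-identityʳ (f j) ⟩
  f j                                ∎
  where open ≡-Reasoning

≐-refl : ∀ {m n} {A : Mat m n} → A ≐ A
≐-refl _ _ = refl

≐-sym : ∀ {m n} {A B : Mat m n} → A ≐ B → B ≐ A
≐-sym p i j = sym (p i j)

≐-trans : ∀ {m n} {A B C : Mat m n} → A ≐ B → B ≐ C → A ≐ C
≐-trans p q i j = trans (p i j) (q i j)

≐-setoid : ℕ → ℕ → Setoid _ _
≐-setoid m n = record
  { Carrier       = Mat m n
  ; _≈_           = _≐_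
  ; isEquivalence = record { refl = ≐-refl ; sym = ≐-sym ; trans = ≐-trans }
  }

module ≐-Reasoning {m n : ℕ} = SetoidReasoning (≐-setoid m n)

·-cong : ∀ {m k n} {A A′ : Mat m k} {B B′ : Mat k n} → A ≐ A′ → B ≐ B′ → A · B ≐ A′ · B′
·-cong p q i j = ∑-cong (λ l → cong₂ _*_ (p i l) (q l j))

⊕-cong : ∀ {m n} {A A′ B B′ : Mat m n} → A ≐ A′ → B ≐ B′ → A ⊕ B ≐ A′ ⊕ B′
⊕-cong p q i j = cong₂ _+_ (p i j) (q i j)

⊙-cong : ∀ {m n} (c : ℤ) {A A′ : Mat m n} → A ≐ A′ → c ⊙ A ≐ c ⊙ A′
⊙-cong c p i j = cong (c *_) (p i j)

ᵗ-cong : ∀ {m n} {A A′ : Mat m n} → A ≐ A′ → A ᵗ ≐ A′ ᵗ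
ᵗ-cong p i j = p j i

·-assoc : ∀ {m k l n} (A : Mat m k) (B : Mat k l) (C : Mat l n) → (A · B) · C ≐ A · (B · C)
·-assoc A B C i j = begin
  ∑ (λ l → ∑ (λ m → A i m * B m l) * C l j)  ≡⟨ ∑-cong (λ l → sym (∑-*ʳ (C l j) (λ m → A i m * B m l))) ⟩
  ∑ (λ l → ∑ (λ m → A i m * B m l * C l j))  ≡⟨ ∑-swap (λ l m → A i m * B m l * C l j) ⟩
  ∑ (λ m → ∑ (λ l → A i m * B m l * C l j))  ≡⟨ ∑-cong (λ m → ∑-cong (λ l → *-assoc (A i m) (B m l) (C l j))) ⟩
  ∑ (λ m → ∑ (λ l → A i m * (B m l * C l j))) ≡⟨ ∑-cong (λ m → ∑-*ˡ (A i m) (λ l → B m l * C l j)) ⟩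
  ∑ (λ m → A i m * ∑ (λ l → B m l * C l j))  ∎
  where open ≡-Reasoning

ᵗ-· : ∀ {m k n} (A : Mat m k) (B : Mat k n) → (A · B) ᵗ ≐ (B ᵗ) · (A ᵗ)
ᵗ-· A B i j = ∑-cong (λ l → *-comm (A j l) (B l i))

·-⊕ : ∀ {m k n} (A : Mat m k) (B C : Mat k n) → A · (B ⊕ C) ≐ (A · B) ⊕ (A · C)
·-⊕ A B C i j = trans (∑-cong (λ l → *-distribˡ-+ (A i l) (B l j) (C l j)))
                      (∑-+ (λ l → A i l * B l j) (λ l → A i l * C l j))

⊕-· : ∀ {m k n} (A B : Mat m k) (C : Mat k n) → (A ⊕ B) · C ≐ (A · C) ⊕ (B · C)
⊕-· A B C i j = trans (∑-cong (λ l → *-distribʳ-+ (C l j) (A i l) (B i l)))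
                      (∑-+ (λ l → A i l * C l j) (λ l → B i l * C l j))

·-⊙ : ∀ {m k n} (A : Mat m k) (c : ℤ) (B : Mat k n) → A · (c ⊙ B) ≐ c ⊙ (A · B)
·-⊙ A c B i j = trans (∑-cong (λ l → lemma (A i l) c (B l j))) (∑-*ˡ c (λ l → A i l * B l j))
  where
  lemma : ∀ a c b → a * (c * b) ≡ c * (a * b)
  lemma = solve-∀

⊙-· : ∀ {m k n} (c : ℤ) (A : Mat m k) (B : Mat k n) → (c ⊙ A) · B ≐ c ⊙ (A · B)
⊙-· c A B i j = trans (∑-cong (λ l → *-assoc c (A i l) (B l j))) (∑-*ˡ c (λ l → A i l * B l j))

identity-diag : ∀ {n} (j : Fin n) → identity j j ≡ 1ℤ
identity-diag {suc n} zero    = refl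
identity-diag {suc n} (suc j) = identity-diag j

identity-off : ∀ {n} (i j : Fin n) → i ≢ j → identity i j ≡ 0ℤ
identity-off {suc n} zero    zero    i≢j = ⊥-elim (i≢j refl)
identity-off {suc n} zero    (suc j) i≢j = refl
identity-off {suc n} (suc i) zero    i≢j = refl
identity-off {suc n} (suc i) (suc j) i≢j = identity-off i j (λ i≡j → i≢j (cong suc i≡j))

·-identityʳ : ∀ {m n} (A : Mat m n) → A · identity ≐ A
·-identityʳ A i j = trans (∑-δ _ j (λ l l≢j → trans (cong (A i l *_) (identity-off l j l≢j)) (*-zeroʳ (A i l))))
                         (trans (cong (A i j *_) (identity-diag j)) (*-identityʳ (A i j)))

·-identityˡ : ∀ {m n} (A : Mat m n) → identity · A ≐ A
·-identityˡ A i j = trans (∑-δ _ i (λ l l≢i → trans (cong (_* A l j) (identity-off i l (λ i≡l → l≢i (sym i≡l)))) (*-zeroˡ (A l j))))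
                         (trans (cong (_* A i j) (identity-diag i)) (*-identityˡ (A i j)))

·-insertAt-zero : ∀ {k n} (a : Fin k → ℤ) (B : Mat k n) (p c : Fin (suc n)) →
  ∑ (λ l → a l * insertAt (B l) p 0ℤ c) ≡ insertAt (λ j → ∑ (λ l → a l * B l j)) p 0ℤ c
·-insertAt-zero a B zero    zero    = ∑-zero (λ l → *-zeroʳ (a l))
·-insertAt-zero a B zero    (suc c) = refl
·-insertAt-zero {n = suc n} a B (suc p) zero    = refl
·-insertAt-zero {n = suc n} a B (suc p) (suc c) = ·-insertAt-zero a (λ l j → B l (suc j)) p c

·-appendZeroCol : ∀ {m k n} (A : Mat m k) (B : Mat k n) → A · appendZeroCol B ≐ appendZeroCol (A · B)
·-appendZeroCol {n = n} A B i = ·-insertAt-zero (A i) B (fromℕ n)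

sg : ∀ {n} → Fin n → ℤ
sg j = sign (toℕ j)

sign-suc : ∀ k → sign (suc k) ≡ - sign k
sign-suc zero          = refl
sign-suc (suc zero)    = refl
sign-suc (suc (suc k)) = sign-suc k

minor : ∀ {n} → Fin (suc n) → Mat (suc n) (suc n) → Mat n n
minor j M i k = M (suc i) (punchIn j k)

AgreeOff : ∀ {n} → Fin n → Mat n n → Mat n n → Set
AgreeOff r A B = ∀ i → i ≢ r → ∀ k → A i k ≡ B i k

agreeOff-sym : ∀ {n} {r : Fin n} {A B : Mat n n} → AgreeOff r A B → AgreeOff r B A
agreeOff-sym agree i i≢r k = sym (agree i i≢r k)

agreeOff-trans : ∀ {n} {r : Fin n} {A B C : Mat n n} → AgreeOff r A B → AgreeOff r B C → AgreeOff r A C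
agreeOff-trans agree agree′ i i≢r k = trans (agree i i≢r k) (agree′ i i≢r k)

agreeOff-minor : ∀ {n} {r : Fin n} {A B : Mat (suc n) (suc n)} →
  AgreeOff (suc r) A B → ∀ j → AgreeOff r (minor j A) (minor j B)
agreeOff-minor agree j i i≢r k = agree (suc i) (λ e → i≢r (suc-injective e)) (punchIn j k)

Extensional : ∀ {n} → (Mat n n → ℤ) → Set
Extensional D = ∀ {A B} → A ≐ B → D A ≡ D B

Additive : ∀ {n} → (Mat n n → ℤ) → Set
Additive {n} D = ∀ (r : Fin n) {A B C} → AgreeOff r A C → AgreeOff r B C →
  (∀ k → C r k ≡ A r k + B r k) → D C ≡ D A + D B

Homogeneous : ∀ {n} → (Mat n n → ℤ) → Set
Homogeneous {n} D = ∀ (r : Fin n) (c : ℤ) {A C} → AgreeOff r A C →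
  (∀ k → C r k ≡ c * A r k) → D C ≡ c * D A

Alternating : ∀ {n} → (Mat n n → ℤ) → Set
Alternating {n} D = ∀ {A} (a b : Fin n) → a ≢ b → (∀ k → A a k ≡ A b k) → D A ≡ 0ℤ

record IsAlternatingForm {n} (D : Mat n n → ℤ) : Set where
  field
    extensional : Extensional D
    additive    : Additive D
    homogeneous : Homogeneous D
    alternating : Alternating D

-- The Laplace determinant is a multilinear function of the rows: for row 0
-- this is read off the definition, for lower rows it follows by induction
-- through the minors.
det-extensional : ∀ {n} → Extensional (det {n})
det-extensional {zero}  A≐B = refl
det-extensional {suc n} A≐B = ∑-cong λ j →
  cong₂ (λ a d → sg j * (a * d)) (A≐B zero j) (det-extensional (λ i k → A≐B (suc i) (punchIn j k)))

det-additive : ∀ {n} → Additive (det {n})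
det-additive {suc n} zero {A} {B} {C} agreeA agreeB rowC = begin
  ∑ (λ j → sg j * (C zero j * det (minor j C)))
    ≡⟨ ∑-cong (λ j → cong₂ (λ c d → sg j * (c * d)) (rowC j) (det-extensional (sameMinor (agreeOff-sym agreeA) j))) ⟩
  ∑ (λ j → sg j * ((A zero j + B zero j) * det (minor j A)))
    ≡⟨ ∑-cong (λ j → split (sg j) (A zero j) (B zero j) _ (det-extensional (sameMinor (agreeOff-trans agreeA (agreeOff-sym agreeB)) j)))⟩
  ∑ (λ j → sg j * (A zero j * det (minor j A)) + sg j * (B zero j * det (minor j B)))
    ≡⟨ ∑-+ (λ j → sg j * (A zero j * det (minor j A))) (λ j → sg j * (B zero j * det (minor j B))) ⟩
  det A + det B ∎
  where
  open ≡-Reasoning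
  sameMinor : ∀ {X Y} → AgreeOff zero X Y → ∀ j → minor j X ≐ minor j Y
  sameMinor agree j i k = agree (suc i) (λ ()) (punchIn j k)
  split : ∀ s a b d {d′} → d ≡ d′ → s * ((a + b) * d) ≡ s * (a * d) + s * (b * d′)
  split s a b d refl = distrib s a b d
    where
    distrib : ∀ s a b d → s * ((a + b) * d) ≡ s * (a * d) + s * (b * d)
    distrib = solve-∀
det-additive {suc n} (suc r) {A} {B} {C} agreeA agreeB rowC = begin
  ∑ (λ j → sg j * (C zero j * det (minor j C)))
    ≡⟨ ∑-cong (λ j → cong (λ d → sg j * (C zero j * d))
         (det-additive r (agreeOff-minor agreeA j) (agreeOff-minor agreeB j) (λ k → rowC (punchIn j k)))) ⟩
  ∑ (λ j → sg j * (C zero j * (det (minor j A) + det (minor j B))))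
    ≡⟨ ∑-cong (λ j → split (sg j) (C zero j) (det (minor j A)) (det (minor j B))
         (sym (agreeA zero (λ ()) j)) (sym (agreeB zero (λ ()) j))) ⟩
  ∑ (λ j → sg j * (A zero j * det (minor j A)) + sg j * (B zero j * det (minor j B)))
    ≡⟨ ∑-+ (λ j → sg j * (A zero j * det (minor j A))) (λ j → sg j * (B zero j * det (minor j B))) ⟩
  det A + det B ∎
  where
  open ≡-Reasoning
  split : ∀ s c a b {c₁ c₂} → c ≡ c₁ → c ≡ c₂ → s * (c * (a + b)) ≡ s * (c₁ * a) + s * (c₂ * b)
  split s c a b refl refl = distrib s c a b
    where
    distrib : ∀ s c a b → s * (c * (a + b)) ≡ s * (c * a) + s * (c * b)
    distrib = solve-∀

det-homogeneous : ∀ {n} → Homogeneous (det {n})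
det-homogeneous {suc n} zero c {A} {C} agreeA rowC = begin
  ∑ (λ j → sg j * (C zero j * det (minor j C)))
    ≡⟨ ∑-cong (λ j → cong₂ (λ x d → sg j * (x * d)) (rowC j)
         (det-extensional (λ i k → sym (agreeA (suc i) (λ ()) (punchIn j k))))) ⟩
  ∑ (λ j → sg j * ((c * A zero j) * det (minor j A)))
    ≡⟨ ∑-cong (λ j → pull (sg j) c (A zero j) (det (minor j A))) ⟩
  ∑ (λ j → c * (sg j * (A zero j * det (minor j A))))
    ≡⟨ ∑-*ˡ c (λ j → sg j * (A zero j * det (minor j A))) ⟩
  c * det A ∎
  where
  open ≡-Reasoning
  pull : ∀ s c a d → s * ((c * a) * d) ≡ c * (s * (a * d))
  pull = solve-∀
det-homogeneous {suc n} (suc r) c {A} {C} agreeA rowC = begin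
  ∑ (λ j → sg j * (C zero j * det (minor j C)))
    ≡⟨ ∑-cong (λ j → cong₂ (λ x d → sg j * (x * d)) (sym (agreeA zero (λ ()) j))
         (det-homogeneous r c (agreeOff-minor agreeA j) (λ k → rowC (punchIn j k)))) ⟩
  ∑ (λ j → sg j * (A zero j * (c * det (minor j A))))
    ≡⟨ ∑-cong (λ j → pull (sg j) c (A zero j) (det (minor j A))) ⟩
  ∑ (λ j → c * (sg j * (A zero j * det (minor j A))))
    ≡⟨ ∑-*ˡ c (λ j → sg j * (A zero j * det (minor j A))) ⟩
  c * det A ∎
  where
  open ≡-Reasoning
  pull : ∀ s c a d → s * (a * (c * d)) ≡ c * (s * (a * d))
  pull = solve-∀

setRow : ∀ {n} → Mat n n → Fin n → (Fin n → ℤ) → Mat n n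
setRow A r v = updateAt A r (const v)

setRow-row : ∀ {n} (A : Mat n n) r v k → setRow A r v r k ≡ v k
setRow-row A r v k = cong-app (updateAt-updates r A) k

setRow-agreeOff : ∀ {n} (A : Mat n n) r v → AgreeOff r (setRow A r v) A
setRow-agreeOff A r v i i≢r k = cong-app (updateAt-minimal i r A i≢r) k

setRow-agreeOff-cong : ∀ {n} {r : Fin n} {A B : Mat n n} → AgreeOff r A B →
  ∀ s v → AgreeOff r (setRow A s v) (setRow B s v)
setRow-agreeOff-cong {A = A} {B} agree s v i i≢r k with i ≟ s
... | yes refl = trans (setRow-row A i v k) (sym (setRow-row B i v k))
... | no i≢s   = trans (setRow-agreeOff A s v i i≢s k)
                       (trans (agree i i≢r k) (sym (setRow-agreeOff B s v i i≢s k)))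

rows-ext : ∀ {n} {X Y : Mat n n} (a b : Fin n) → (∀ k → X a k ≡ Y a k) → (∀ k → X b k ≡ Y b k) →
  (∀ i → i ≢ a → i ≢ b → ∀ k → X i k ≡ Y i k) → X ≐ Y
rows-ext a b rowa rowb rest i k with i ≟ a | i ≟ b
... | yes refl | _        = rowa k
... | no _     | yes refl = rowb k
... | no i≢a   | no i≢b   = rest i i≢a i≢b k

setTwoRows : ∀ {n} → Mat n n → Fin n → Fin n → (Fin n → ℤ) → (Fin n → ℤ) → Mat n n
setTwoRows A a b u v = setRow (setRow A b v) a u

setTwoRows-a : ∀ {n} (A : Mat n n) a b u v k → setTwoRows A a b u v a k ≡ u k
setTwoRows-a A a b u v = setRow-row (setRow A b v) a u

setTwoRows-b : ∀ {n} (A : Mat n n) {a b} → a ≢ b → ∀ u v k → setTwoRows A a b u v b k ≡ v k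
setTwoRows-b A {a} {b} a≢b u v k =
  trans (setRow-agreeOff (setRow A b v) a u b (λ b≡a → a≢b (sym b≡a)) k) (setRow-row A b v k)

setTwoRows-rest : ∀ {n} (A : Mat n n) a b u v i → i ≢ a → i ≢ b → ∀ k → setTwoRows A a b u v i k ≡ A i k
setTwoRows-rest A a b u v i i≢a i≢b k = trans (setRow-agreeOff _ a u i i≢a k) (setRow-agreeOff A b v i i≢b k)

setTwoRows-agreeOffˡ : ∀ {n} (A : Mat n n) a b {u u′ v} → AgreeOff a (setTwoRows A a b u v) (setTwoRows A a b u′ v)
setTwoRows-agreeOffˡ A a b {u} {u′} {v} =
  agreeOff-trans (setRow-agreeOff (setRow A b v) a u) (agreeOff-sym (setRow-agreeOff (setRow A b v) a u′))

setTwoRows-agreeOffʳ : ∀ {n} (A : Mat n n) a b {u v v′} → AgreeOff b (setTwoRows A a b u v) (setTwoRows A a b u v′)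
setTwoRows-agreeOffʳ A a b {u} {v} {v′} =
  setRow-agreeOff-cong (agreeOff-trans (setRow-agreeOff A b v) (agreeOff-sym (setRow-agreeOff A b v′))) a u

module AlternatingFormProperties {n} {D : Mat n n → ℤ} (isForm : IsAlternatingForm D) where
  open IsAlternatingForm isForm

  zeroRow : ∀ {A} r → (∀ k → A r k ≡ 0ℤ) → D A ≡ 0ℤ
  zeroRow {A} r row≡0 =
    trans (homogeneous r 0ℤ (λ _ _ _ → refl) (λ k → trans (row≡0 k) (sym (*-zeroˡ (A r k)))))
          (*-zeroˡ (D A))

  addRowMultiple : ∀ {A A′} r s → r ≢ s → (c : ℤ) → AgreeOff r A A′ →
    (∀ k → A′ r k ≡ A r k + c * A s k) → D A′ ≡ D A
  addRowMultiple {A} {A′} r s r≢s c agree rowA′ = begin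
    D A′       ≡⟨ additive r agree (agreeOff-trans (setRow-agreeOff A r _) agree) rowA′′ ⟩
    D A + D B  ≡⟨ cong (D A +_) D[B]≡0 ⟩
    D A + 0ℤ   ≡⟨ +-identityʳ (D A) ⟩
    D A        ∎
    where
    open ≡-Reasoning
    B E : Mat n n
    B = setRow A r (λ k → c * A s k)
    E = setRow A r (A s)
    rowA′′ : ∀ k → A′ r k ≡ A r k + B r k
    rowA′′ k = trans (rowA′ k) (cong (A r k +_) (sym (setRow-row A r _ k)))
    D[B]≡0 : D B ≡ 0ℤ
    D[B]≡0 = begin
      D B      ≡⟨ homogeneous r c (agreeOff-trans (setRow-agreeOff A r _) (agreeOff-sym (setRow-agreeOff A r _)))
                    (λ k → trans (setRow-row A r _ k) (cong (c *_) (sym (setRow-row A r _ k)))) ⟩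
      c * D E  ≡⟨ cong (c *_) (alternating r s r≢s (λ k →
                    trans (setRow-row A r _ k) (sym (setRow-agreeOff A r _ s (λ s≡r → r≢s (sym s≡r)) k)))) ⟩
      c * 0ℤ   ≡⟨ *-zeroʳ c ⟩
      0ℤ       ∎

  -- Exchanging two rows negates the value: expand D at the matrix with
  -- x + y in both rows a and b, where x and y are the rows a and b of A.
  swapRows : ∀ {A S} a b → a ≢ b → (∀ k → S a k ≡ A b k) → (∀ k → S b k ≡ A a k) →
    (∀ i → i ≢ a → i ≢ b → ∀ k → S i k ≡ A i k) → D S ≡ - D A
  swapRows {A} {S} a b a≢b rowSa rowSb rest = begin
    D S                      ≡⟨ cancel (D A) (D S) ⟨
    (D A + D S) + - D A      ≡⟨ cong (_+ - D A) expansion ⟨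
    0ℤ + - D A               ≡⟨ +-identityˡ (- D A) ⟩
    - D A                    ∎
    where
    open ≡-Reasoning
    T : (Fin n → ℤ) → (Fin n → ℤ) → Mat n n
    T = setTwoRows A a b
    additiveˡ : ∀ u u′ v → D (T (λ k → u k + u′ k) v) ≡ D (T u v) + D (T u′ v)
    additiveˡ u u′ v = additive a (setTwoRows-agreeOffˡ A a b) (setTwoRows-agreeOffˡ A a b)
      (λ k → trans (setTwoRows-a A a b _ v k) (sym (cong₂ _+_ (setTwoRows-a A a b u v k) (setTwoRows-a A a b u′ v k))))
    additiveʳ : ∀ u v v′ → D (T u (λ k → v k + v′ k)) ≡ D (T u v) + D (T u v′)
    additiveʳ u v v′ = additive b (setTwoRows-agreeOffʳ A a b) (setTwoRows-agreeOffʳ A a b)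
      (λ k → trans (setTwoRows-b A a≢b u _ k) (sym (cong₂ _+_ (setTwoRows-b A a≢b u v k) (setTwoRows-b A a≢b u v′ k))))
    diagonal : ∀ u → D (T u u) ≡ 0ℤ
    diagonal u = alternating a b a≢b (λ k → trans (setTwoRows-a A a b u u k) (sym (setTwoRows-b A a≢b u u k)))
    x y : Fin n → ℤ
    x = A a
    y = A b
    x+y : Fin n → ℤ
    x+y k = x k + y k
    at-A : D (T x y) ≡ D A
    at-A = extensional (rows-ext a b (setTwoRows-a A a b x y) (setTwoRows-b A a≢b x y) (setTwoRows-rest A a b x y))
    at-S : D (T y x) ≡ D S
    at-S = extensional (rows-ext a b (λ k → trans (setTwoRows-a A a b y x k) (sym (rowSa k)))
                                    (λ k → trans (setTwoRows-b A a≢b y x k) (sym (rowSb k)))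
      (λ i i≢a i≢b k → trans (setTwoRows-rest A a b y x i i≢a i≢b k) (sym (rest i i≢a i≢b k))))
    expansion : 0ℤ ≡ D A + D S
    expansion = begin
      0ℤ                                                 ≡⟨ diagonal x+y ⟨
      D (T x+y x+y)                                      ≡⟨ additiveˡ x y x+y ⟩
      D (T x x+y) + D (T y x+y)                          ≡⟨ cong₂ _+_ (additiveʳ x x y) (additiveʳ y x y) ⟩
      (D (T x x) + D (T x y)) + (D (T y x) + D (T y y))  ≡⟨ cong₂ _+_ (cong₂ _+_ (diagonal x) at-A) (cong₂ _+_ at-S (diagonal y)) ⟩
      (0ℤ + D A) + (D S + 0ℤ)                            ≡⟨ cong₂ _+_ (+-identityˡ (D A)) (+-identityʳ (D S)) ⟩
      D A + D S                                          ∎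
    cancel : ∀ a s → (a + s) + - a ≡ s
    cancel = solve-∀

-- The key case, two equal top rows, uses the
-- double Laplace expansion along rows 0 and 1, indexed by pairs of columns.
-- collapse j c is the index of column c once column j is deleted (the
-- inverse of punchIn j; its value at c = j is irrelevant).
collapse : ∀ {m} → Fin (suc (suc m)) → Fin (suc (suc m)) → Fin (suc m)
collapse zero    zero    = zero
collapse zero    (suc c) = c
collapse (suc j) zero    = zero
collapse {suc m} (suc j) (suc c) = suc (collapse j c)
collapse {zero}  (suc j) (suc c) = zero

collapse-punchIn : ∀ {m} (j : Fin (suc (suc m))) (k : Fin (suc m)) → collapse j (punchIn j k) ≡ k
collapse-punchIn zero    k       = refl
collapse-punchIn (suc j) zero    = refl
collapse-punchIn {suc m} (suc j) (suc k) = cong suc (collapse-punchIn j k)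

punchIn-collapse : ∀ {m} (j c : Fin (suc (suc m))) → j ≢ c → (l : Fin m) →
  punchIn j (punchIn (collapse j c) l) ≡ punchIn c (punchIn (collapse c j) l)
punchIn-collapse zero    zero    j≢c l = ⊥-elim (j≢c refl)
punchIn-collapse zero    (suc c) j≢c l = refl
punchIn-collapse (suc j) zero    j≢c l = refl
punchIn-collapse {suc m} (suc j) (suc c) j≢c zero    = refl
punchIn-collapse {suc m} (suc j) (suc c) j≢c (suc l) =
  cong suc (punchIn-collapse j c (λ j≡c → j≢c (cong suc j≡c)) l)

sign-collapse : ∀ {m} (j c : Fin (suc (suc m))) → j ≢ c →
  sg j * sg (collapse j c) ≡ - (sg c * sg (collapse c j))
sign-collapse zero    zero    j≢c = ⊥-elim (j≢c refl)
sign-collapse zero    (suc c) j≢c = trans (*-identityˡ (sg c))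
  (sym (trans (cong -_ (trans (*-identityʳ (sg (suc c))) (sign-suc (toℕ c)))) (neg-involutive (sg c))))
sign-collapse (suc j) zero    j≢c = trans (*-identityʳ (sg (suc j)))
  (trans (sign-suc (toℕ j)) (cong -_ (sym (*-identityˡ (sg j)))))
sign-collapse {suc m} (suc j) (suc c) j≢c = begin
  sg (suc j) * sg (suc (collapse j c))      ≡⟨ cong₂ _*_ (sign-suc (toℕ j)) (sign-suc (toℕ (collapse j c))) ⟩
  (- sg j) * (- sg (collapse j c))          ≡⟨ neg*neg (sg j) (sg (collapse j c)) ⟩
  sg j * sg (collapse j c)                  ≡⟨ sign-collapse j c (λ j≡c → j≢c (cong suc j≡c)) ⟩
  - (sg c * sg (collapse c j))              ≡⟨ cong -_ (neg*neg (sg c) (sg (collapse c j))) ⟨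
  - ((- sg c) * (- sg (collapse c j)))      ≡⟨ cong -_ (cong₂ _*_ (sign-suc (toℕ c)) (sign-suc (toℕ (collapse c j)))) ⟨
  - (sg (suc c) * sg (suc (collapse c j)))  ∎
  where
  open ≡-Reasoning
  neg*neg : ∀ a b → (- a) * (- b) ≡ a * b
  neg*neg = solve-∀
sign-collapse {zero} (suc zero) (suc zero) j≢c = ⊥-elim (j≢c refl)

module _ {m : ℕ} where
  private
    N : ℕ
    N = suc (suc m)

  swapTop : Mat N N → Mat N N
  swapTop M zero          = M (suc zero)
  swapTop M (suc zero)    = M zero
  swapTop M (suc (suc i)) = M (suc (suc i))

  -- The term of the Laplace expansion along rows 0 and 1 using columns j and c;
  -- for c = j it is a spurious "diagonal" term.
  twoRowTerm : Mat N N → Fin N → Fin N → ℤ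
  twoRowTerm M j c = sg j * (M zero j * (sg (collapse j c) * (M (suc zero) c *
    det (λ i l → M (suc (suc i)) (punchIn j (punchIn (collapse j c) l))))))

  -- Expanding every minor along its top row: det M is the sum of all
  -- off-diagonal two-row terms.
  twoRowExpansion : ∀ M → det M + ∑ (λ j → twoRowTerm M j j) ≡ ∑ (λ j → ∑ (twoRowTerm M j))
  twoRowExpansion M = begin
    det M + ∑ (λ j → twoRowTerm M j j)
      ≡⟨ ∑-+ (λ j → sg j * (M zero j * det (minor j M))) (λ j → twoRowTerm M j j) ⟨
    ∑ (λ j → sg j * (M zero j * det (minor j M)) + twoRowTerm M j j)
      ≡⟨ ∑-cong (λ j → trans (+-comm _ (twoRowTerm M j j))
           (sym (trans (∑-punchIn (twoRowTerm M j) j) (cong (_+_ (twoRowTerm M j j)) (offDiagonal j))))) ⟩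
    ∑ (λ j → ∑ (twoRowTerm M j)) ∎
    where
    open ≡-Reasoning
    offDiagonal : ∀ j → ∑ (λ k → twoRowTerm M j (punchIn j k)) ≡ sg j * (M zero j * det (minor j M))
    offDiagonal j = begin
      ∑ (λ k → twoRowTerm M j (punchIn j k))
        ≡⟨ ∑-cong (λ k → cong (λ k′ → sg j * (M zero j * (sg k′ * (M (suc zero) (punchIn j k) *
             det (λ i l → M (suc (suc i)) (punchIn j (punchIn k′ l))))))) (collapse-punchIn j k)) ⟩
      ∑ (λ k → sg j * (M zero j * (sg k * (minor j M zero k * det (minor k (minor j M))))))
        ≡⟨ ∑-*ˡ (sg j) (λ k → M zero j * (sg k * (minor j M zero k * det (minor k (minor j M))))) ⟩
      sg j * ∑ (λ k → M zero j * (sg k * (minor j M zero k * det (minor k (minor j M)))))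
        ≡⟨ cong (sg j *_) (∑-*ˡ (M zero j) (λ k → sg k * (minor j M zero k * det (minor k (minor j M))))) ⟩
      sg j * (M zero j * det (minor j M)) ∎

  twoRowTerm-antisymmetric : ∀ M j c → j ≢ c → twoRowTerm (swapTop M) j c + twoRowTerm M c j ≡ 0ℤ
  twoRowTerm-antisymmetric M j c j≢c = begin
    sg j * (y * (sg (collapse j c) * (x * d))) + sg c * (x * (sg (collapse c j) * (y * d′)))
      ≡⟨ cong (λ t → sg j * (y * (sg (collapse j c) * (x * d))) + sg c * (x * (sg (collapse c j) * (y * t))))
           (det-extensional (λ i l → cong (M (suc (suc i))) (sym (punchIn-collapse j c j≢c l)))) ⟩
    sg j * (y * (sg (collapse j c) * (x * d))) + sg c * (x * (sg (collapse c j) * (y * d)))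
      ≡⟨ regroup (sg j) (sg (collapse j c)) (sg c) (sg (collapse c j)) x y d ⟩
    (sg j * sg (collapse j c) + sg c * sg (collapse c j)) * (x * y * d)
      ≡⟨ cong (λ s → (s + sg c * sg (collapse c j)) * (x * y * d)) (sign-collapse j c j≢c) ⟩
    (- (sg c * sg (collapse c j)) + sg c * sg (collapse c j)) * (x * y * d)
      ≡⟨ cong (_* (x * y * d)) (+-inverseˡ (sg c * sg (collapse c j))) ⟩
    0ℤ * (x * y * d)
      ≡⟨ *-zeroˡ (x * y * d) ⟩
    0ℤ ∎
    where
    open ≡-Reasoning
    x y d d′ : ℤ
    x = M zero c
    y = M (suc zero) j
    d = det (λ i l → M (suc (suc i)) (punchIn j (punchIn (collapse j c) l)))
    d′ = det (λ i l → M (suc (suc i)) (punchIn c (punchIn (collapse c j) l)))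
    regroup : ∀ a b a′ b′ x y d → a * (y * (b * (x * d))) + a′ * (x * (b′ * (y * d))) ≡ (a * b + a′ * b′) * (x * y * d)
    regroup = solve-∀

  twoRowTerm-diagonal : ∀ M j → twoRowTerm (swapTop M) j j ≡ twoRowTerm M j j
  twoRowTerm-diagonal M j = exchange (sg j) (M (suc zero) j) (sg (collapse j j)) (M zero j)
    (det (λ i l → M (suc (suc i)) (punchIn j (punchIn (collapse j j) l))))
    where
    exchange : ∀ s a t b d → s * (a * (t * (b * d))) ≡ s * (b * (t * (a * d)))
    exchange = solve-∀

  det-swapTop : ∀ M → det (swapTop M) + det M ≡ 0ℤ
  det-swapTop M = begin
    det (swapTop M) + det M                               ≡⟨ regroup (det (swapTop M)) (det M) P ⟩
    ((det (swapTop M) + P) + (det M + P)) + - (P + P)     ≡⟨ cong (λ t → t + - (P + P)) (cong₂ _+_ expandSwapped (twoRowExpansion M)) ⟩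
    (S (swapTop M) + S M) + - (P + P)                     ≡⟨ cong (λ t → t + - (P + P)) pairing ⟩
    (P + P) + - (P + P)                                   ≡⟨ +-inverseʳ (P + P) ⟩
    0ℤ                                                    ∎
    where
    open ≡-Reasoning
    P : ℤ
    P = ∑ (λ j → twoRowTerm M j j)
    S : Mat N N → ℤ
    S X = ∑ (λ j → ∑ (twoRowTerm X j))
    expandSwapped : det (swapTop M) + P ≡ S (swapTop M)
    expandSwapped = trans (cong (_+_ (det (swapTop M))) (∑-cong (λ j → sym (twoRowTerm-diagonal M j))))
                          (twoRowExpansion (swapTop M))
    pairing : S (swapTop M) + S M ≡ P + P
    pairing = begin
      S (swapTop M) + S M
        ≡⟨ cong (_+_ (S (swapTop M))) (∑-swap (twoRowTerm M)) ⟩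
      S (swapTop M) + ∑ (λ j → ∑ (λ c → twoRowTerm M c j))
        ≡⟨ ∑-+ (λ j → ∑ (twoRowTerm (swapTop M) j)) (λ j → ∑ (λ c → twoRowTerm M c j)) ⟨
      ∑ (λ j → ∑ (twoRowTerm (swapTop M) j) + ∑ (λ c → twoRowTerm M c j))
        ≡⟨ ∑-cong (λ j → trans (sym (∑-+ (twoRowTerm (swapTop M) j) (λ c → twoRowTerm M c j)))
             (∑-δ _ j (λ c c≢j → twoRowTerm-antisymmetric M j c (λ j≡c → c≢j (sym j≡c))))) ⟩
      ∑ (λ j → twoRowTerm (swapTop M) j j + twoRowTerm M j j)
        ≡⟨ ∑-+ (λ j → twoRowTerm (swapTop M) j j) (λ j → twoRowTerm M j j) ⟩
      ∑ (λ j → twoRowTerm (swapTop M) j j) + P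
        ≡⟨ cong (_+ P) (∑-cong (twoRowTerm-diagonal M)) ⟩
      P + P ∎
    regroup : ∀ a b p → a + b ≡ ((a + p) + (b + p)) + - (p + p)
    regroup = solve-∀

self-cancelling : ∀ a → a + a ≡ 0ℤ → a ≡ 0ℤ
self-cancelling (ℤ.+ zero)  _ = refl
self-cancelling (ℤ.+ suc n) ()
self-cancelling -[1+ n ]  ()

det-equalTopRows : ∀ {m} (M : Mat (suc (suc m)) (suc (suc m))) → (∀ k → M zero k ≡ M (suc zero) k) → det M ≡ 0ℤ
det-equalTopRows M top≡ = self-cancelling (det M) (trans (cong (_+ det M) (det-extensional swapTop≐M)) (det-swapTop M))
  where
  swapTop≐M : M ≐ swapTop M
  swapTop≐M zero          k = top≡ k
  swapTop≐M (suc zero)    k = sym (top≡ k)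
  swapTop≐M (suc (suc i)) k = refl

det-isAlternatingForm : ∀ {n} → Alternating (det {n}) → IsAlternatingForm (det {n})
det-isAlternatingForm alternating = record
  { extensional = det-extensional
  ; additive    = det-additive
  ; homogeneous = det-homogeneous
  ; alternating = alternating
  }

-- Exchanging two rows below the top negates det, provided det is
-- alternating one size down (apply swapRows to every minor).
det-swapLower : ∀ {n} → Alternating (det {n}) → ∀ {M S : Mat (suc n) (suc n)} (a b : Fin n) → a ≢ b →
  (∀ k → S (suc a) k ≡ M (suc b) k) → (∀ k → S (suc b) k ≡ M (suc a) k) →
  (∀ i → i ≢ suc a → i ≢ suc b → ∀ k → S i k ≡ M i k) → det S ≡ - det M
det-swapLower {n} alternating {M} {S} a b a≢b rowSa rowSb rest = begin
  ∑ (λ j → sg j * (S zero j * det (minor j S)))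
    ≡⟨ ∑-cong (λ j → trans (cong₂ (λ x d → sg j * (x * d)) (rest zero (λ ()) (λ ()) j) (swapMinor j))
         (negate (sg j) (M zero j) (det (minor j M)))) ⟩
  ∑ (λ j → - (sg j * (M zero j * det (minor j M))))
    ≡⟨ ∑-neg (λ j → sg j * (M zero j * det (minor j M))) ⟩
  - det M ∎
  where
  open ≡-Reasoning
  open AlternatingFormProperties (det-isAlternatingForm alternating)
  swapMinor : ∀ j → det (minor j S) ≡ - det (minor j M)
  swapMinor j = swapRows a b a≢b (λ k → rowSa (punchIn j k)) (λ k → rowSb (punchIn j k))
    (λ i i≢a i≢b k → rest (suc i) (λ e → i≢a (suc-injective e)) (λ e → i≢b (suc-injective e)) (punchIn j k))
  negate : ∀ s x d → s * (x * (- d)) ≡ - (s * (x * d))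
  negate = solve-∀

-- A matrix whose top row is repeated further down has determinant zero:
-- move the repeated row to position 1 by a swap below the top.
det-repeatedTopRow : ∀ {n} → Alternating (det {n}) → ∀ (M : Mat (suc n) (suc n)) b →
  (∀ k → M zero k ≡ M (suc b) k) → det M ≡ 0ℤ
det-repeatedTopRow {suc n} alternating M zero    repeated = det-equalTopRows M repeated
det-repeatedTopRow {suc n} alternating M (suc b) repeated = begin
  det M       ≡⟨ neg-involutive (det M) ⟨
  - (- det M) ≡⟨ cong -_ det[S]≡-det[M] ⟨
  - det S     ≡⟨ cong -_ det[S]≡0 ⟩
  0ℤ          ∎
  where
  open ≡-Reasoning
  r₁ r₂ : Fin (suc (suc n))
  r₁ = suc zero
  r₂ = suc (suc b)
  r₁≢r₂ : r₁ ≢ r₂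
  r₁≢r₂ ()
  S₁ S : Mat (suc (suc n)) (suc (suc n))
  S₁ = setRow M r₁ (M r₂)
  S = setRow S₁ r₂ (M r₁)
  row₁ : ∀ k → S r₁ k ≡ M r₂ k
  row₁ k = trans (setRow-agreeOff S₁ r₂ (M r₁) r₁ r₁≢r₂ k) (setRow-row M r₁ (M r₂) k)
  det[S]≡-det[M] : det S ≡ - det M
  det[S]≡-det[M] = det-swapLower alternating zero (suc b) (λ ()) row₁ (setRow-row S₁ r₂ (M r₁))
    (λ i i≢r₁ i≢r₂ k → trans (setRow-agreeOff S₁ r₂ (M r₁) i i≢r₂ k) (setRow-agreeOff M r₁ (M r₂) i i≢r₁ k))
  det[S]≡0 : det S ≡ 0ℤ
  det[S]≡0 = det-equalTopRows S (λ k → trans (setRow-agreeOff S₁ r₂ (M r₁) zero (λ ()) k)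
    (trans (setRow-agreeOff M r₁ (M r₂) zero (λ ()) k) (trans (repeated k) (sym (row₁ k)))))

det-alternating : ∀ {n} → Alternating (det {n})
det-alternating {suc n} zero    zero    a≢b equal = ⊥-elim (a≢b refl)
det-alternating {suc n} {M} zero    (suc b) a≢b equal = det-repeatedTopRow det-alternating M b equal
det-alternating {suc n} {M} (suc a) zero    a≢b equal = det-repeatedTopRow det-alternating M a (λ k → sym (equal k))
det-alternating {suc n} {M} (suc a) (suc b) a≢b equal = trans
  (∑-cong (λ j → cong (λ d → sg j * (M zero j * d))
    (det-alternating a b (λ a≡b → a≢b (cong suc a≡b)) (λ k → equal (punchIn j k)))))
  (∑-zero (λ j → trans (cong (sg j *_) (*-zeroʳ (M zero j))) (*-zeroʳ (sg j))))

ins : ∀ {n} → Fin (suc n) → (Fin n → ℤ) → Fin (suc n) → ℤ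
ins j x = insertAt x j 0ℤ

data PunchInView {n} (j : Fin (suc n)) : Fin (suc n) → Set where
  self   : PunchInView j j
  other  : (k : Fin n) → PunchInView j (punchIn j k)

punchInView : ∀ {n} (j c : Fin (suc n)) → PunchInView j c
punchInView j c with j ≟ c
... | yes refl = self
... | no j≢c   = subst (PunchInView j) (punchIn-punchOut j≢c) (other (punchOut j≢c))

ins-pointwise : ∀ {n} (f : ℤ → ℤ → ℤ) → f 0ℤ 0ℤ ≡ 0ℤ → (j : Fin (suc n)) {x y z : Fin n → ℤ} →
  (∀ k → z k ≡ f (x k) (y k)) → ∀ c → ins j z c ≡ f (ins j x c) (ins j y c)
ins-pointwise f f00 j {x} {y} {z} z≡ c with punchInView j c
... | self    = trans (insertAt-lookup z j 0ℤ)
                  (sym (trans (cong₂ f (insertAt-lookup x j 0ℤ) (insertAt-lookup y j 0ℤ)) f00))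
... | other k = trans (insertAt-punchIn z j 0ℤ k)
                  (trans (z≡ k) (sym (cong₂ f (insertAt-punchIn x j 0ℤ k) (insertAt-punchIn y j 0ℤ k))))

ins-cong : ∀ {n} (j : Fin (suc n)) {x y : Fin n → ℤ} → (∀ k → x k ≡ y k) → ∀ c → ins j x c ≡ ins j y c
ins-cong j {x} = ins-pointwise (λ _ b → b) refl j {x = x}

clearEntry : ∀ {n} (j : Fin (suc n)) (x : Fin (suc n) → ℤ) c →
  x c + (- x j) * identity j c ≡ ins j (λ k → x (punchIn j k)) c
clearEntry j x c with punchInView j c
... | self    = trans (cong (λ e → x j + (- x j) * e) (identity-diag j))
                  (trans (cancel (x j)) (sym (insertAt-lookup _ j 0ℤ)))
  where
  cancel : ∀ a → a + (- a) * 1ℤ ≡ 0ℤ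
  cancel = solve-∀
... | other k = trans (cong (λ e → x (punchIn j k) + (- x j) * e)
                         (identity-off j (punchIn j k) (λ e → punchInᵢ≢i j k (sym e))))
                  (trans (drop (x (punchIn j k)) (x j)) (sym (insertAt-punchIn _ j 0ℤ k)))
  where
  drop : ∀ a b → a + (- b) * 0ℤ ≡ a
  drop = solve-∀

-- Zero-insertion into unit vectors: the rows of the permutation matrices
-- bordered (suc j) identity and bordered (inject₁ j) identity of UniquenessStep.
ins-suc-unit : ∀ {n} (j : Fin n) c → ins (suc j) (identity j) c ≡ identity (inject₁ j) c
ins-suc-unit {suc n} zero    zero          = refl
ins-suc-unit {suc n} zero    (suc zero)    = refl
ins-suc-unit {suc n} zero    (suc (suc c)) = refl
ins-suc-unit {suc n} (suc j) zero          = refl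
ins-suc-unit {suc n} (suc j) (suc c)       = ins-suc-unit j c

ins-inject₁-unit : ∀ {n} (j : Fin n) c → ins (inject₁ j) (identity j) c ≡ identity (suc j) c
ins-inject₁-unit {suc n} zero    zero          = refl
ins-inject₁-unit {suc n} zero    (suc zero)    = refl
ins-inject₁-unit {suc n} zero    (suc (suc c)) = refl
ins-inject₁-unit {suc n} (suc j) zero          = refl
ins-inject₁-unit {suc n} (suc j) (suc c)       = ins-inject₁-unit j c

ins-suc≡ins-inject₁ : ∀ {n} (x : Fin n → ℤ) j → x j ≡ 0ℤ → ∀ c → ins (suc j) x c ≡ ins (inject₁ j) x c
ins-suc≡ins-inject₁ {suc n} x zero    x₀≡0 zero          = x₀≡0
ins-suc≡ins-inject₁ {suc n} x zero    x₀≡0 (suc zero)    = sym x₀≡0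
ins-suc≡ins-inject₁ {suc n} x zero    x₀≡0 (suc (suc c)) = refl
ins-suc≡ins-inject₁ {suc n} x (suc j) xⱼ≡0 zero          = refl
ins-suc≡ins-inject₁ {suc n} x (suc j) xⱼ≡0 (suc c)       = ins-suc≡ins-inject₁ (λ l → x (suc l)) j xⱼ≡0 c

dropAt : ∀ {n} → (Fin n → ℤ) → Fin n → Fin n → ℤ
dropAt c i₀ = updateAt c i₀ (const 0ℤ)

dropAt-at : ∀ {n} (c : Fin n → ℤ) i₀ → dropAt c i₀ i₀ ≡ 0ℤ
dropAt-at c i₀ = updateAt-updates i₀ c

dropAt-other : ∀ {n} (c : Fin n → ℤ) i₀ i → i ≢ i₀ → dropAt c i₀ i ≡ c i
dropAt-other c i₀ i i≢i₀ = updateAt-minimal i i₀ c i≢i₀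

VanishesFrom : ∀ {n} → ℕ → (Fin n → ℤ) → Set
VanishesFrom t c = ∀ i → t ℕ.≤ toℕ i → c i ≡ 0ℤ

vanishesFrom-beyond : ∀ {n t} (c : Fin n → ℤ) → ¬ (t ℕ.< n) → VanishesFrom t c
vanishesFrom-beyond c t≮n i t≤i = ⊥-elim (t≮n (ℕₚ.≤-<-trans t≤i (toℕ<n i)))

vanishesFrom-dropAt : ∀ {n t} {c : Fin n → ℤ} (t<n : t ℕ.< n) → VanishesFrom (suc t) c →
  VanishesFrom t (dropAt c (fromℕ< t<n))
vanishesFrom-dropAt {c = c} t<n c≡0 i t≤i with i ≟ fromℕ< t<n
... | yes refl = dropAt-at c i
... | no i≢t   = trans (dropAt-other c _ i i≢t) (c≡0 i (ℕₚ.≤∧≢⇒< t≤i (λ t≡i → i≢t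
                   (toℕ-injective (trans (sym t≡i) (sym (toℕ-fromℕ< t<n)))))))

module UniquenessStep {n} {D : Mat (suc n) (suc n) → ℤ} (isForm : IsAlternatingForm D)
  (uniqueness : ∀ {E : Mat n n → ℤ} → IsAlternatingForm E → ∀ N → E N ≡ det N * E identity) where

  open IsAlternatingForm isForm
  open AlternatingFormProperties isForm

  expandTopRow : ∀ {m} (c : Fin m → ℤ) (v : Fin m → Fin (suc n) → ℤ) (R : Mat n (suc n)) →
    D ((λ k → ∑ (λ l → c l * v l k)) ∷ R) ≡ ∑ (λ l → c l * D (v l ∷ R))
  expandTopRow {zero}  c v R = zeroRow zero (λ k → refl)
  expandTopRow {suc m} c v R = begin
    D ((λ k → ∑ (λ l → c l * v l k)) ∷ R)
      ≡⟨ additive zero sameBelow sameBelow (λ k → refl) ⟩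
    D ((λ k → c zero * v zero k) ∷ R) + D ((λ k → ∑ (λ l → c (suc l) * v (suc l) k)) ∷ R)
      ≡⟨ cong₂ _+_ (homogeneous zero (c zero) sameBelow (λ k → refl))
                   (expandTopRow (λ l → c (suc l)) (λ l → v (suc l)) R) ⟩
    c zero * D (v zero ∷ R) + ∑ (λ l → c (suc l) * D (v (suc l) ∷ R)) ∎
    where
    open ≡-Reasoning
    sameBelow : ∀ {u u′} → AgreeOff zero (u ∷ R) (u′ ∷ R)
    sameBelow zero    0≢0 k = ⊥-elim (0≢0 refl)
    sameBelow (suc i) _   k = refl

  shifted : (Fin (suc n) → ℤ) → Mat n (suc n) → (Fin n → ℤ) → Mat (suc n) (suc n)
  shifted v R c = v ∷ λ i k → R i k + c i * v k

  -- Undoing the shift of a single row i₀ is a row operation.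
  dropShift : ∀ v R c i₀ → D (shifted v R c) ≡ D (shifted v R (dropAt c i₀))
  dropShift v R c i₀ = addRowMultiple (suc i₀) zero (λ ()) (c i₀) sameOff
    (λ k → reshift (R i₀ k) (c i₀) (v k) (dropAt-at c i₀))
    where
    sameOff : AgreeOff (suc i₀) (shifted v R (dropAt c i₀)) (shifted v R c)
    sameOff zero    _    k = refl
    sameOff (suc i) i≢i₀ k = cong (λ e → R i k + e * v k) (dropAt-other c i₀ i (λ e → i≢i₀ (cong suc e)))
    reshift : ∀ r c v {z} → z ≡ 0ℤ → r + c * v ≡ (r + z * v) + c * v
    reshift r c v refl = sym (cancelZero r c v)
      where
      cancelZero : ∀ r c v → (r + 0ℤ * v) + c * v ≡ r + c * v
      cancelZero = solve-∀

  -- Shifting the rows below by multiples of the top row does not change D;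
  -- by induction on a bound t beyond which the shifts vanish.
  clearBelow : ∀ v R c → D (v ∷ R) ≡ D (shifted v R c)
  clearBelow v R c = shiftUpTo n c (vanishesFrom-beyond c (ℕₚ.<-irrefl refl))
    where
    shiftUpTo : ∀ t c → VanishesFrom t c → D (v ∷ R) ≡ D (shifted v R c)
    shiftUpTo zero c c≡0 = extensional λ
      { zero    k → refl
      ; (suc i) k → sym (trans (cong (λ e → R i k + e * v k) (c≡0 i z≤n))
                               (trans (cong (R i k +_) (*-zeroˡ (v k))) (+-identityʳ (R i k)))) }
    shiftUpTo (suc t) c c≡0 with t ℕ.<? n
    ... | no t≮n  = shiftUpTo t c (vanishesFrom-beyond c t≮n)
    ... | yes t<n = trans (shiftUpTo t (dropAt c (fromℕ< t<n)) (vanishesFrom-dropAt t<n c≡0))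
                          (sym (dropShift v R c (fromℕ< t<n)))

  bordered : Fin (suc n) → Mat n n → Mat (suc n) (suc n)
  bordered l N = identity l ∷ λ i → ins l (N i)

  bordered-isForm : ∀ l → IsAlternatingForm (λ N → D (bordered l N))
  bordered-isForm l = record
    { extensional = λ N≐N′ → extensional (rows N≐N′)
    ; additive    = λ r agreeA agreeB rowC → additive (suc r) (below agreeA) (below agreeB)
                      (ins-pointwise _+_ refl l rowC)
    ; homogeneous = λ r c {A} agree rowC → homogeneous (suc r) c (below agree)
                      (ins-pointwise (λ _ b → c * b) (*-zeroʳ c) l {x = A r} rowC)
    ; alternating = λ a b a≢b equal → alternating (suc a) (suc b) (λ e → a≢b (suc-injective e))
                      (ins-cong l equal)
    }
    where
    rows : ∀ {N N′} → N ≐ N′ → bordered l N ≐ bordered l N′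
    rows N≐N′ zero    k = refl
    rows N≐N′ (suc i) k = ins-cong l (N≐N′ i) k
    below : ∀ {r N N′} → AgreeOff r N N′ → AgreeOff (suc r) (bordered l N) (bordered l N′)
    below agree zero    _      k = refl
    below agree (suc i) i≢r  k = ins-cong l (agree i (λ e → i≢r (cong suc e))) k

  -- bordered l identity is a permutation matrix: the rows of the identity
  -- with row l moved to the top. Moving it back takes l exchanges.
  bordered-identity : ∀ t (l : Fin (suc n)) → toℕ l ≡ t → D (bordered l identity) ≡ sg l * D identity
  bordered-identity zero zero _ = trans (extensional atZero) (sym (*-identityˡ (D identity)))
    where
    atZero : bordered zero identity ≐ identity
    atZero zero    k       = refl
    atZero (suc i) zero    = refl
    atZero (suc i) (suc k) = refl
  bordered-identity (suc t) (suc j) l≡t = begin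
    D (bordered (suc j) identity)        ≡⟨ swapRows zero (suc j) (λ ()) (λ k → sym (ins-inject₁-unit j k))
                                              (ins-suc-unit j) otherRows ⟩
    - D (bordered (inject₁ j) identity)  ≡⟨ cong -_ (bordered-identity t (inject₁ j)
                                              (trans (toℕ-inject₁ j) (ℕₚ.suc-injective l≡t))) ⟩
    - (sg (inject₁ j) * D identity)      ≡⟨ cong (λ s → - (sign s * D identity)) (toℕ-inject₁ j) ⟩
    - (sg j * D identity)                ≡⟨ neg-distribˡ-* (sg j) (D identity) ⟩
    (- sg j) * D identity                ≡⟨ cong (_* D identity) (sign-suc (toℕ j)) ⟨
    sg (suc j) * D identity              ∎
    where
    open ≡-Reasoning
    otherRows : ∀ i → i ≢ zero → i ≢ suc j → ∀ k → bordered (suc j) identity i k ≡ bordered (inject₁ j) identity i k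
    otherRows zero    i≢0 _ k = ⊥-elim (i≢0 refl)
    otherRows (suc i) _ i≢j k = ins-suc≡ins-inject₁ (identity i) j (identity-off i j (λ e → i≢j (cong suc e))) k

  unitTopRow : ∀ M l → D (identity l ∷ λ i → M (suc i)) ≡ det (minor l M) * (sg l * D identity)
  unitTopRow M l = begin
    D (identity l ∷ λ i → M (suc i))
      ≡⟨ clearBelow (identity l) (λ i → M (suc i)) (λ i → - M (suc i) l) ⟩
    D (identity l ∷ λ i k → M (suc i) k + (- M (suc i) l) * identity l k)
      ≡⟨ extensional cleared ⟩
    D (bordered l (minor l M))
      ≡⟨ uniqueness (bordered-isForm l) (minor l M) ⟩
    det (minor l M) * D (bordered l identity)
      ≡⟨ cong (det (minor l M) *_) (bordered-identity (toℕ l) l refl) ⟩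
    det (minor l M) * (sg l * D identity) ∎
    where
    open ≡-Reasoning
    cleared : (identity l ∷ λ i k → M (suc i) k + (- M (suc i) l) * identity l k) ≐ bordered l (minor l M)
    cleared zero    k = refl
    cleared (suc i) k = clearEntry l (M (suc i)) k

  -- Expanding the top row in the unit vectors gives the Laplace expansion.
  determined : ∀ M → D M ≡ det M * D identity
  determined M = begin
    D M
      ≡⟨ extensional topRowInBasis ⟩
    D ((λ k → ∑ (λ l → M zero l * identity l k)) ∷ λ i → M (suc i))
      ≡⟨ expandTopRow (M zero) identity (λ i → M (suc i)) ⟩
    ∑ (λ l → M zero l * D (identity l ∷ λ i → M (suc i)))
      ≡⟨ ∑-cong (λ l → trans (cong (M zero l *_) (unitTopRow M l))
                             (regroup (M zero l) (det (minor l M)) (sg l) (D identity))) ⟩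
    ∑ (λ l → sg l * (M zero l * det (minor l M)) * D identity)
      ≡⟨ ∑-*ʳ (D identity) (λ l → sg l * (M zero l * det (minor l M))) ⟩
    det M * D identity ∎
    where
    open ≡-Reasoning
    topRowInBasis : M ≐ ((λ k → ∑ (λ l → M zero l * identity l k)) ∷ λ i → M (suc i))
    topRowInBasis zero    k = sym (·-identityʳ M zero k)
    topRowInBasis (suc i) k = refl
    regroup : ∀ m d s x → m * (d * (s * x)) ≡ s * (m * d) * x
    regroup = solve-∀

alternatingForm-unique : ∀ n {D : Mat n n → ℤ} → IsAlternatingForm D → ∀ M → D M ≡ det M * D identity
alternatingForm-unique zero    isForm M = trans (IsAlternatingForm.extensional isForm (λ ())) (sym (*-identityˡ _))
alternatingForm-unique (suc n) isForm   = UniquenessStep.determined isForm (alternatingForm-unique n)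

-- The determinant is multiplicative: M ↦ det (M · B) is an alternating form.
det-· : ∀ {n} (A B : Mat n n) → det (A · B) ≡ det A * det B
det-· {n} A B = trans (alternatingForm-unique n isForm A) (cong (det A *_) (det-extensional (·-identityˡ B)))
  where
  rowsOf· : ∀ {r X Y} → AgreeOff r X Y → AgreeOff r (X · B) (Y · B)
  rowsOf· agree i i≢r k = ∑-cong (λ l → cong (_* B l k) (agree i i≢r l))
  isForm : IsAlternatingForm (λ M → det (M · B))
  isForm = record
    { extensional = λ X≐Y → det-extensional (·-cong X≐Y (λ _ _ → refl))
    ; additive    = λ r {X} {Y} agreeX agreeY rowC → det-additive r (rowsOf· agreeX) (rowsOf· agreeY)
        (λ k → trans (∑-cong (λ l → trans (cong (_* B l k) (rowC l)) (*-distribʳ-+ (B l k) (X r l) (Y r l))))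
                     (∑-+ (λ l → X r l * B l k) (λ l → Y r l * B l k)))
    ; homogeneous = λ r c {X} agree rowC → det-homogeneous r c (rowsOf· agree)
        (λ k → trans (∑-cong (λ l → trans (cong (_* B l k) (rowC l)) (*-assoc c (X r l) (B l k))))
                     (∑-*ˡ c (λ l → X r l * B l k)))
    ; alternating = λ a b a≢b equal → det-alternating a b a≢b (λ k → ∑-cong (λ l → cong (_* B l k) (equal l)))
    }

IsUnit : ℤ → Set
IsUnit x = x ≡ 1ℤ ⊎ x ≡ -1ℤ

isUnit-* : ∀ {a b} → IsUnit a → IsUnit b → IsUnit (a * b)
isUnit-* (inj₁ refl) (inj₁ refl) = inj₁ refl
isUnit-* (inj₁ refl) (inj₂ refl) = inj₂ refl
isUnit-* (inj₂ refl) (inj₁ refl) = inj₂ refl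
isUnit-* (inj₂ refl) (inj₂ refl) = inj₁ refl

isUnit-factor : ∀ a b → a * b ≡ 1ℤ → IsUnit b
isUnit-factor a b ab≡1 = fromAbs b (ℕₚ.m*n≡1⇒n≡1 ∣ a ∣ ∣ b ∣ (trans (sym (abs-* a b)) (cong ∣_∣ ab≡1)))
  where
  fromAbs : ∀ b → ∣ b ∣ ≡ 1 → IsUnit b
  fromAbs (ℤ.+ 1)           _ = inj₁ refl
  fromAbs -[1+ 0 ]        _ = inj₂ refl
  fromAbs (ℤ.+ 0)           ()
  fromAbs (ℤ.+ suc (suc n)) ()
  fromAbs -[1+ suc n ]    ()

unimodular-· : ∀ {n} (U H : Mat n n) → Unimodular U → Unimodular H → Unimodular (U · H)
unimodular-· U H unimodularU unimodularH =
  subst IsUnit (sym (det-· U H)) (isUnit-* unimodularU unimodularH)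

row-inLattice : ∀ {n} (G : Mat n n) i → InLattice G (G i)
row-inLattice G i = identity i , λ j → ·-identityˡ G i j

coefficients : ∀ {n} {G H : Mat n n} → (∀ i → InLattice G (H i)) → Σ (Mat n n) λ U → U · G ≐ H
coefficients inLattice = (λ i → proj₁ (inLattice i)) , (λ i → proj₂ (inLattice i))

det-leftInverse : ∀ {n} {U V G : Mat n n} → det G ≢ 0ℤ → V · (U · G) ≐ G → det V * det U ≡ 1ℤ
det-leftInverse {U = U} {V} {G} det≢0 VUG≐G = *-cancelʳ-≡ (det V * det U) 1ℤ (det G) {{≢-nonZero det≢0}} (begin
  det V * det U * det G    ≡⟨ *-assoc (det V) (det U) (det G) ⟩
  det V * (det U * det G)  ≡⟨ cong (det V *_) (det-· U G) ⟨
  det V * det (U · G)      ≡⟨ det-· V (U · G) ⟨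
  det (V · (U · G))        ≡⟨ det-extensional VUG≐G ⟩
  det G                    ≡⟨ *-identityˡ (det G) ⟨
  1ℤ * det G               ∎)
  where open ≡-Reasoning

basisChange : ∀ {n} {G₁ G₂ : Mat n n} → det G₁ ≢ 0ℤ → (∀ v → InLattice G₁ v ⇔ InLattice G₂ v) →
  Σ (Mat n n) λ U → (U · G₁ ≐ G₂) × Unimodular U
basisChange {G₁ = G₁} {G₂} det≢0 sameLattice
  with coefficients (λ i → Equivalence.from (sameLattice (G₂ i)) (row-inLattice G₂ i))
     | coefficients (λ i → Equivalence.to (sameLattice (G₁ i)) (row-inLattice G₁ i))
... | U , U·G₁≐G₂ | V , V·G₂≐G₁ =
  U , U·G₁≐G₂ , isUnit-factor (det V) (det U)
                  (det-leftInverse det≢0 (λ i j → trans (·-cong {A = V} ≐-refl U·G₁≐G₂ i j) (V·G₂≐G₁ i j)))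

appendZeroCol-basisChange : ∀ {n} {U Ḡ₁ Ḡ₂ : Mat n n} → U · Ḡ₁ ≐ Ḡ₂ → appendZeroCol Ḡ₂ ≐ U · appendZeroCol Ḡ₁
appendZeroCol-basisChange {n} {U} {Ḡ₁} UḠ₁≐Ḡ₂ i k =
  trans (ins-cong (fromℕ n) (λ j → sym (UḠ₁≐Ḡ₂ i j)) k) (sym (·-appendZeroCol U Ḡ₁ i k))

Gw-basisChange : ∀ {n} (U : Mat n n) {G₁ G₂ : Mat n (suc n)} (P : Mat n (suc n)) w →
  G₂ ≐ U · G₁ → Gw w G₂ (U · P) ≐ U · Gw w G₁ P
Gw-basisChange U {G₁} {G₂} P w G₂≐UG₁ = begin
  ((ℤ.+ w) ⊙ G₂) ⊕ (U · P)          ≈⟨ ⊕-cong (⊙-cong (ℤ.+ w) G₂≐UG₁) (≐-refl {A = U · P}) ⟩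
  ((ℤ.+ w) ⊙ (U · G₁)) ⊕ (U · P)    ≈⟨ ⊕-cong (·-⊙ U (ℤ.+ w) G₁) (≐-refl {A = U · P}) ⟨
  (U · ((ℤ.+ w) ⊙ G₁)) ⊕ (U · P)    ≈⟨ ·-⊕ U ((ℤ.+ w) ⊙ G₁) P ⟨
  U · Gw w G₁ P                     ∎
  where open ≐-Reasoning

·-ᵗ-congruence : ∀ {m n k} (U : Mat m n) (X Y : Mat n k) → (U · X) · ((U · Y) ᵗ) ≐ (U · (X · (Y ᵗ))) · (U ᵗ)
·-ᵗ-congruence U X Y = begin
  (U · X) · ((U · Y) ᵗ)         ≈⟨ ·-cong (≐-refl {A = U · X}) (ᵗ-· U Y) ⟩
  (U · X) · ((Y ᵗ) · (U ᵗ))     ≈⟨ ·-assoc (U · X) (Y ᵗ) (U ᵗ) ⟨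
  ((U · X) · (Y ᵗ)) · (U ᵗ)     ≈⟨ ·-cong (·-assoc U X (Y ᵗ)) (≐-refl {A = U ᵗ}) ⟩
  (U · (X · (Y ᵗ))) · (U ᵗ)     ∎
  where open ≐-Reasoning

symmetrised-congruence : ∀ {m n k} (U : Mat m n) (G P : Mat n k) →
  ((U · G) · ((U · P) ᵗ)) ⊕ ((U · P) · ((U · G) ᵗ)) ≐ (U · ((G · (P ᵗ)) ⊕ (P · (G ᵗ)))) · (U ᵗ)
symmetrised-congruence U G P = begin
  ((U · G) · ((U · P) ᵗ)) ⊕ ((U · P) · ((U · G) ᵗ))
    ≈⟨ ⊕-cong (·-ᵗ-congruence U G P) (·-ᵗ-congruence U P G) ⟩
  ((U · (G · (P ᵗ))) · (U ᵗ)) ⊕ ((U · (P · (G ᵗ))) · (U ᵗ))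
    ≈⟨ ⊕-· (U · (G · (P ᵗ))) (U · (P · (G ᵗ))) (U ᵗ) ⟨
  ((U · (G · (P ᵗ))) ⊕ (U · (P · (G ᵗ)))) · (U ᵗ)
    ≈⟨ ·-cong (·-⊕ U (G · (P ᵗ)) (P · (G ᵗ))) (≐-refl {A = U ᵗ}) ⟨
  (U · ((G · (P ᵗ)) ⊕ (P · (G ᵗ)))) · (U ᵗ) ∎
  where open ≐-Reasoning

⊙-congruence : ∀ {m n} (c : ℤ) (U : Mat m n) (X : Mat n n) → c ⊙ ((U · X) · (U ᵗ)) ≐ (U · (c ⊙ X)) · (U ᵗ)
⊙-congruence c U X = begin
  c ⊙ ((U · X) · (U ᵗ))   ≈⟨ ⊙-· c (U · X) (U ᵗ) ⟨
  (c ⊙ (U · X)) · (U ᵗ)   ≈⟨ ·-cong (·-⊙ U c X) (≐-refl {A = U ᵗ}) ⟨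
  (U · (c ⊙ X)) · (U ᵗ)   ∎
  where open ≐-Reasoning

gram-basisChange : ∀ {n} {U Ḡ₁ Ḡ₂ : Mat n n} → U · Ḡ₁ ≐ Ḡ₂ → (U · (Ḡ₁ · (Ḡ₁ ᵗ))) · (U ᵗ) ≐ Ḡ₂ · (Ḡ₂ ᵗ)
gram-basisChange {U = U} {Ḡ₁} UḠ₁≐Ḡ₂ = ≐-trans (≐-sym (·-ᵗ-congruence U Ḡ₁ Ḡ₁)) (·-cong UḠ₁≐Ḡ₂ (ᵗ-cong UḠ₁≐Ḡ₂))

symCond-transport : ∀ {n} {G P G′ P′ : Mat n (suc n)} {A A′ : Mat n n} (U : Mat n n) →
  G′ ≐ U · G → P′ ≐ U · P → (U · A) · (U ᵗ) ≐ A′ → SymCond G P A → SymCond G′ P′ A′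
symCond-transport {G = G} {P} {G′} {P′} {A} {A′} U G′≐UG P′≐UP UAUᵗ≐A′ (p , q , condition) = p , q , (begin
  c ⊙ ((G′ · (P′ ᵗ)) ⊕ (P′ · (G′ ᵗ)))
    ≈⟨ ⊙-cong c (⊕-cong (·-cong G′≐UG (ᵗ-cong P′≐UP)) (·-cong P′≐UP (ᵗ-cong G′≐UG))) ⟩
  c ⊙ (((U · G) · ((U · P) ᵗ)) ⊕ ((U · P) · ((U · G) ᵗ)))
    ≈⟨ ⊙-cong c (symmetrised-congruence U G P) ⟩
  c ⊙ ((U · ((G · (P ᵗ)) ⊕ (P · (G ᵗ)))) · (U ᵗ))
    ≈⟨ ⊙-congruence c U ((G · (P ᵗ)) ⊕ (P · (G ᵗ))) ⟩
  (U · (c ⊙ ((G · (P ᵗ)) ⊕ (P · (G ᵗ))))) · (U ᵗ)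
    ≈⟨ ·-cong (·-cong (≐-refl {A = U}) condition) (≐-refl {A = U ᵗ}) ⟩
  (U · (p ⊙ A)) · (U ᵗ)
    ≈⟨ ⊙-congruence p U A ⟨
  p ⊙ ((U · A) · (U ᵗ))
    ≈⟨ ⊙-cong p UAUᵗ≐A′ ⟩
  p ⊙ A′ ∎)
  where
  open ≐-Reasoning
  c : ℤ
  c = ℤ.+ suc q

inverse-transport : ∀ {n} {U H₁ H₂ M₁ M₂ : Mat n n} →
  H₂ ≐ U · H₁ → M₂ · H₂ ≐ identity → H₁ · M₁ ≐ identity → M₂ · U ≐ M₁
inverse-transport {U = U} {H₁} {H₂} {M₁} {M₂} H₂≐UH₁ M₂H₂≐I H₁M₁≐I = begin
  M₂ · U                  ≈⟨ ·-identityʳ (M₂ · U) ⟨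
  (M₂ · U) · identity     ≈⟨ ·-cong (≐-refl {A = M₂ · U}) H₁M₁≐I ⟨
  (M₂ · U) · (H₁ · M₁)    ≈⟨ ·-assoc (M₂ · U) H₁ M₁ ⟨
  ((M₂ · U) · H₁) · M₁    ≈⟨ ·-cong (·-assoc M₂ U H₁) (≐-refl {A = M₁}) ⟩
  (M₂ · (U · H₁)) · M₁    ≈⟨ ·-cong (·-cong (≐-refl {A = M₂}) H₂≐UH₁) (≐-refl {A = M₁}) ⟨
  (M₂ · H₂) · M₁          ≈⟨ ·-cong M₂H₂≐I (≐-refl {A = M₁}) ⟩
  identity · M₁           ≈⟨ ·-identityˡ M₁ ⟩
  M₁                      ∎
  where open ≐-Reasoning

inverse-quotient : ∀ {n k} {U H₁ H₂ M₁ M₂ : Mat n n} {G₁ G₂ : Mat n k} →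
  G₂ ≐ U · G₁ → H₂ ≐ U · H₁ → IsInverse M₁ H₁ → IsInverse M₂ H₂ → M₁ · G₁ ≐ M₂ · G₂
inverse-quotient {U = U} {H₁} {H₂} {M₁} {M₂} {G₁} {G₂} G₂≐UG₁ H₂≐UH₁ (_ , H₁M₁≐I) (M₂H₂≐I , _) = begin
  M₁ · G₁          ≈⟨ ·-cong (inverse-transport {U = U} {H₁} {H₂} {M₁} {M₂} H₂≐UH₁ M₂H₂≐I H₁M₁≐I) (≐-refl {A = G₁}) ⟨
  (M₂ · U) · G₁    ≈⟨ ·-assoc M₂ U G₁ ⟩
  M₂ · (U · G₁)    ≈⟨ ·-cong (≐-refl {A = M₂}) G₂≐UG₁ ⟨
  M₂ · G₂          ∎
  where open ≐-Reasoning

proposition1 : (n : ℕ) → 1 ≤ n →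
    (Ḡ₁ Ḡ₂ : Mat n n) →
    det Ḡ₁ ≢ 0ℤ →
    ((v : Fin n → ℤ) → InLattice Ḡ₁ v ⇔ InLattice Ḡ₂ v) →
    (P₁ : Mat n (suc n)) →
    ((w : ℕ) → Unimodular (lastCols (Gw w (appendZeroCol Ḡ₁) P₁))) →
    SymCond (appendZeroCol Ḡ₁) P₁ (Ḡ₁ · (Ḡ₁ ᵗ)) →
    Σ (Mat n (suc n)) λ P₂ →
      ((w : ℕ) → Unimodular (lastCols (Gw w (appendZeroCol Ḡ₂) P₂)))
      × SymCond (appendZeroCol Ḡ₂) P₂ (Ḡ₂ · (Ḡ₂ ᵗ))
      × ((w : ℕ) → (M₁ M₂ : Mat n n) →
          IsInverse M₁ (lastCols (Gw w (appendZeroCol Ḡ₁) P₁)) →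
          IsInverse M₂ (lastCols (Gw w (appendZeroCol Ḡ₂) P₂)) →
          (M₁ · appendZeroCol Ḡ₁) ≐ (M₂ · appendZeroCol Ḡ₂))
proposition1 n _ Ḡ₁ Ḡ₂ det≢0 sameLattice P₁ unimodular₁ symCond₁ with basisChange det≢0 sameLattice
... | U , UḠ₁≐Ḡ₂ , unimodularU = U · P₁ , unimodular₂ , symCond₂ , sameQuotient
  where
  G₁ : Mat n (suc n)
  G₁ = appendZeroCol Ḡ₁
  G₂≐UG₁ : appendZeroCol Ḡ₂ ≐ U · G₁
  G₂≐UG₁ = appendZeroCol-basisChange {U = U} {Ḡ₁} {Ḡ₂} UḠ₁≐Ḡ₂
  H₁ H₂ : ℕ → Mat n n
  H₁ w = lastCols (Gw w G₁ P₁)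
  H₂ w = lastCols (Gw w (appendZeroCol Ḡ₂) (U · P₁))
  H₂≐UH₁ : ∀ w → H₂ w ≐ U · H₁ w
  H₂≐UH₁ w i j = Gw-basisChange U P₁ w G₂≐UG₁ i (suc j)
  unimodular₂ : ∀ w → Unimodular (H₂ w)
  unimodular₂ w = subst IsUnit (sym (det-extensional (H₂≐UH₁ w))) (unimodular-· U (H₁ w) unimodularU (unimodular₁ w))
  symCond₂ : SymCond (appendZeroCol Ḡ₂) (U · P₁) (Ḡ₂ · (Ḡ₂ ᵗ))
  symCond₂ = symCond-transport {G = G₁} {P = P₁} U G₂≐UG₁ ≐-refl (gram-basisChange UḠ₁≐Ḡ₂) symCond₁
  sameQuotient : ∀ w M₁ M₂ → IsInverse M₁ (H₁ w) → IsInverse M₂ (H₂ w) → M₁ · G₁ ≐ M₂ · appendZeroCol Ḡ₂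
  sameQuotient w M₁ M₂ = inverse-quotient {U = U} {H₁ w} {H₂ w} {M₁} {M₂} G₂≐UG₁ (H₂≐UH₁ w)
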